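{- Let $\mathbf a=(a_1,\dots,a_n)$ be a (non-circular) area sequence with $a_n=0$, let $\mathbf s$ be a set of corner edges of $\Gamma_{\mathbf a}$, $\boldsymbol\nu=(\mathbf a,\mathbf s)$, and write $\mathrm G_{\boldsymbol\nu}(\mathbf x;q+1)=\sum_\mu d^{\boldsymbol\nu}_\mu(q)\mathrm e_\mu(\mathbf x)$. Then \[\sum_\mu d^{\boldsymbol\nu}_\mu(q)=(1+q)^{|\boldsymbol\nu|},\] where $|\boldsymbol\nu|$ is the number of non-strict edges of $\Gamma_{\boldsymbol\nu}$, i.e. the number of edges of $\Gamma_{\mathbf a}$.
   Context: $\mathbf a$ satisfies $0\le a_i\le n-1$, $a_i-1\le a_{i+1}$ (indices mod $n$) and $a_n=0$. $\Gamma_{\mathbf a}$ is the directed graph on $[n]$ with edges $i\to i+1,\dots,i\to i+a_i$. A corner edge is a pair $u\to v$ not an edge of $\Gamma_{\mathbf a}$ with $u\to v-1$ and $u+1\to v$ edges; these are marked strict, and $\Gamma_{\boldsymbol\nu}$ is $\Gamma_{\mathbf a}$ together with them. $\mathrm G_{\boldsymbol\nu}(\mathbf x;q)=\sum_F \mathbf x^F q^{\mathrm{asc}_{\mathbf a}(F)}$ over maps $F:[n]\to\mathbb Z_{>0}$ with $F(u)<F(v)$ for each strict corner edge $u\to v$, where $\mathbf x^F=\prod_vx_{F(v)}$ and $\mathrm{asc}_{\mathbf a}(F)$ counts edges $i\to j$ of $\Gamma_{\mathbf a}$ with $F(i)<F(j)$. -}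

module Defs where

open import Data.Nat as ℕ using (ℕ; zero; suc; _∸_; _≤_; _<_; _≤ᵇ_; _<ᵇ_; _<?_)
open import Data.Integer as ℤ using (ℤ; +_; _+_; _*_; _^_)
open import Data.Fin using (Fin; toℕ; fromℕ<) renaming (zero to fz; suc to fs)
open import Data.Bool using (Bool; true; false; _∧_; not; if_then_else_)
open import Data.List using (List; []; _∷_; map; concatMap; allFin; length; filter)
open import Data.Vec as Vec using (Vec; lookup)
open import Data.Product using (_×_; _,_)
open import Relation.Nullary using (yes; no)
open import Relation.Binary.PropositionalEquality using (_≡_)

-- Vertices of [n] are Fin n (0-based: vertex i of Fin n is i+1 in the paper).

sucMod : ∀ {n} → Fin n → Fin n
sucMod {suc m} i with suc (toℕ i) <? suc m
... | yes p = fromℕ< p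
... | no _  = fz

record IsAreaSeq (n : ℕ) (a : Fin n → ℕ) : Set where
  field
    bound : ∀ i → a i ≤ n ∸ 1
    step  : ∀ i → a i ∸ 1 ≤ a (sucMod i)
    last  : ∀ i → toℕ i ≡ n ∸ 1 → a i ≡ 0

-- Edges of Γ_a : i → j for j = i+1, …, i+a_i  (no wrap-around since a_n = 0)
isEdgeᵇ : ∀ {n} → (Fin n → ℕ) → Fin n → Fin n → Bool
isEdgeᵇ a i j = (toℕ i <ᵇ toℕ j) ∧ (toℕ j ≤ᵇ toℕ i ℕ.+ a i)

IsEdge : ∀ {n} → (Fin n → ℕ) → Fin n → Fin n → Set
IsEdge a i j = isEdgeᵇ a i j ≡ true

-- Corner edge u → v: not an edge, but u → v-1 and u+1 → v are edges.
-- (Vertices v-1 and u+1 are given by explicit vertices v' u' with the right values.)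
IsCorner : ∀ {n} → (Fin n → ℕ) → Fin n → Fin n → Set
IsCorner {n} a u v =
  (isEdgeᵇ a u v ≡ false) ×
  ((∀ v' → suc (toℕ v') ≡ toℕ v → IsEdge a u v') ×
   (∀ u' → toℕ u' ≡ suc (toℕ u) → IsEdge a u' v)) ×
  ((Data.Product.Σ (Fin n) λ v' → suc (toℕ v') ≡ toℕ v) ×
   (Data.Product.Σ (Fin n) λ u' → toℕ u' ≡ suc (toℕ u)))

sumℤ : List ℤ → ℤ
sumℤ = Data.List.foldr _+_ (+ 0)

prodℤ : List ℤ → ℤ
prodℤ = Data.List.foldr _*_ (+ 1)

pairs : ∀ n → List (Fin n × Fin n)
pairs n = concatMap (λ i → map (λ j → (i , j)) (allFin n)) (allFin n)

countPairs : ∀ {n} → (Fin n → Fin n → Bool) → ℕ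
countPairs {n} p = length (filter (λ ij → p (Data.Product.proj₁ ij) (Data.Product.proj₂ ij) Data.Bool.≟ true) (pairs n))

allVecs : ∀ n N → List (Vec (Fin N) n)
allVecs zero    N = Vec.[] ∷ []
allVecs (suc n) N = concatMap (λ k → map (k Vec.∷_) (allVecs n N)) (allFin N)

numEdges : ∀ {n} → (Fin n → ℕ) → ℕ
numEdges a = countPairs (isEdgeᵇ a)

asc : ∀ {n N} → (Fin n → ℕ) → (Fin n → Fin N) → ℕ
asc a F = countPairs (λ i j → isEdgeᵇ a i j ∧ (toℕ (F i) <ᵇ toℕ (F j)))

respects : ∀ {n N} → (Fin n → Fin n → Bool) → (Fin n → Fin N) → Bool
respects s F = countPairs (λ u v → s u v ∧ not (toℕ (F u) <ᵇ toℕ (F v))) ℕ.≡ᵇ 0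

-- G_ν(x_1,…,x_N, 0, 0, …; q), i.e. G_ν with all variables x_k, k > N, set to 0
-- (values 1..N of F correspond to Fin N).
Geval : ∀ {n} → (a : Fin n → ℕ) → (s : Fin n → Fin n → Bool) →
        (N : ℕ) → (Fin N → ℤ) → ℤ → ℤ
Geval {n} a s N x q =
  sumℤ (map (λ v → let F = lookup v in
                   if respects s F
                   then prodℤ (map (λ i → x (F i)) (allFin n)) * q ^ asc a F
                   else + 0)
            (allVecs n N))

esym : ∀ N → (Fin N → ℤ) → ℕ → ℤ
esym N       x zero    = + 1
esym zero    x (suc k) = + 0
esym (suc N) x (suc k) = x fz * esym N (λ i → x (fs i)) k + esym N (λ i → x (fs i)) (suc k)

eμ : ∀ N → (Fin N → ℤ) → List ℕ → ℤ
eμ N x μ = prodℤ (map (esym N x) μ)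

-- partitions of m with all parts ≤ k (fuel f ≥ m)
partsB : (f k m : ℕ) → List (List ℕ)
partsB f       k zero    = [] ∷ []
partsB zero    k (suc m) = []
partsB (suc f) k (suc m) =
  concatMap (λ j → map (suc j ∷_) (partsB f (suc j) (suc m ∸ suc j)))
            (filter (λ j → suc j ℕ.≤? k) (filter (λ j → suc j ℕ.≤? suc m) (Data.List.upTo (suc m))))

partitions : ℕ → List (List ℕ)
partitions m = partsB m m m

-- Polynomials in q with integer coefficients (constant term first)

evalPoly : List ℤ → ℤ → ℤ
evalPoly []       q = + 0
evalPoly (c ∷ cs) q = c + q * evalPoly cs q

-- Put x₁ = ⋯ = x_N = 1 and read both sides of the expansion as functions of N. They are polynomials in N
-- of degree at most n, so Newton's forward formula gives them a value at N = −1. As e_k(1^N) = binom(N,k)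
-- takes the value (−1)^k there, every e_μ with |μ| = n contributes (−1)^n and the right-hand side becomes
-- (−1)^n Σ_μ d_μ(q). The left-hand side is a sum over all maps F : [n] → [N] of a weight that depends only
-- on the comparisons F(i) < F(j) for i < j. Sorting the maps into [N+1] by the set of vertices sent to the
-- minimum expresses the first difference of such a sum through sums on fewer vertices, and an involution on
-- these sets shows, by induction on n, that its value at N = −1 is (−1)^n times the weight of a strictly
-- increasing map (a reciprocity in the style of Stanley). A strictly increasing map respects every strict
-- corner edge and makes every edge an ascent, so this weight is (1+q)^{|ν|}.
module Submission where

open import Defs
open import Data.Nat using (ℕ)
open import Data.Integer using (ℤ; +_; _+_; _*_; _^_)
open import Data.Fin using (Fin)
open import Data.Bool using (Bool; true)
open import Data.List using (List; map)
open import Relation.Binary.PropositionalEquality using (_≡_)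

open import Data.Nat as ℕ using (zero; suc; _≤_; _<_; z≤n; s≤s; _<ᵇ_)
import Data.Nat.Properties as ℕₚ
open import Data.Nat.Induction using (<-rec)
open import Data.Nat.ListAction using (sum)
open import Data.Integer using (-_; _-_; -1ℤ; ≢-nonZero)
open import Data.Integer.Properties
  using (+-identityˡ; +-identityʳ; +-inverseʳ; +-assoc; *-identityˡ; *-zeroʳ; *-comm;
         *-distribˡ-+; *-cancelʳ-≡; +-comm; neg-distrib-+; neg-involutive; ^-distribˡ-+-*; i^n≡0⇒i≡0)
open import Data.Integer.Tactic.RingSolver using (solve-∀)
open import Data.Fin using (toℕ) renaming (zero to fz; suc to fs)
open import Data.Fin.Subset using (Subset; inside; outside; ⊥)
open import Data.Bool using (false; _∧_; not; if_then_else_)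
import Data.Bool.Properties as Boolₚ
open import Data.Maybe using (Maybe; just; nothing; is-just)
import Data.Maybe as Maybe
open import Data.List using ([]; _∷_; _++_; concatMap; allFin; filter; length)
import Data.List.Properties as Listₚ
open import Data.List.Relation.Unary.All as All using (All; []; _∷_)
open import Data.List.Relation.Unary.All.Properties using (concat⁺; map⁺; all-filter; filter⁺; ++⁺)
open import Data.Vec using (Vec; []; _∷_; lookup)
import Data.Vec as Vec
import Data.Vec.Properties as Vecₚ
open import Data.Product using (Σ; _×_; _,_)
open import Function using (_∘_; Equivalence)
open import Relation.Binary.PropositionalEquality using (refl; sym; trans; cong; cong₂; _≗_; _≢_; module ≡-Reasoning)

private variable
  A : Set

sum-cong-All : {xs : List A} {f g : A → ℤ} → All (λ x → f x ≡ g x) xs → sumℤ (map f xs) ≡ sumℤ (map g xs)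
sum-cong-All []       = refl
sum-cong-All (e ∷ es) = cong₂ _+_ e (sum-cong-All es)

sum-cong : (xs : List A) {f g : A → ℤ} → f ≗ g → sumℤ (map f xs) ≡ sumℤ (map g xs)
sum-cong xs e = sum-cong-All (All.universal e xs)

sum-map : {B : Set} (xs : List A) (g : A → B) (f : B → ℤ) → sumℤ (map f (map g xs)) ≡ sumℤ (map (f ∘ g) xs)
sum-map xs g f = cong sumℤ (sym (Listₚ.map-∘ xs))

sum-++ : (xs ys : List A) (f : A → ℤ) → sumℤ (map f (xs ++ ys)) ≡ sumℤ (map f xs) + sumℤ (map f ys)
sum-++ []       ys f = sym (+-identityˡ _)
sum-++ (x ∷ xs) ys f = trans (cong (_+_ (f x)) (sum-++ xs ys f)) (sym (+-assoc (f x) _ _))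

sum-concatMap : {B : Set} (xs : List A) (g : A → List B) (f : B → ℤ) →
  sumℤ (map f (concatMap g xs)) ≡ sumℤ (map (λ x → sumℤ (map f (g x))) xs)
sum-concatMap []       g f = refl
sum-concatMap (x ∷ xs) g f =
  trans (sum-++ (g x) (concatMap g xs) f) (cong (_+_ (sumℤ (map f (g x)))) (sum-concatMap xs g f))

sum-zero : (xs : List A) → sumℤ (map (λ _ → + 0) xs) ≡ + 0
sum-zero []       = refl
sum-zero (x ∷ xs) = trans (+-identityˡ _) (sum-zero xs)

sum-+ : (xs : List A) (f g : A → ℤ) → sumℤ (map (λ x → f x + g x) xs) ≡ sumℤ (map f xs) + sumℤ (map g xs)
sum-+ []       f g = refl
sum-+ (x ∷ xs) f g = trans (cong (_+_ (f x + g x)) (sum-+ xs f g)) (interchange (f x) (g x) _ _)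
  where
  interchange : ∀ (a b c d : ℤ) → a + b + (c + d) ≡ (a + c) + (b + d)
  interchange = solve-∀

sum-*ˡ : (xs : List A) (c : ℤ) (f : A → ℤ) → sumℤ (map (λ x → c * f x) xs) ≡ c * sumℤ (map f xs)
sum-*ˡ []       c f = sym (*-zeroʳ c)
sum-*ˡ (x ∷ xs) c f = trans (cong (_+_ (c * f x)) (sum-*ˡ xs c f)) (sym (*-distribˡ-+ c (f x) _))

sum-*ʳ : (xs : List A) (c : ℤ) (f : A → ℤ) → sumℤ (map (λ x → f x * c) xs) ≡ sumℤ (map f xs) * c
sum-*ʳ xs c f = trans (sum-cong xs (λ x → *-comm (f x) c)) (trans (sum-*ˡ xs c f) (*-comm c _))

sum-neg : (xs : List A) (f : A → ℤ) → sumℤ (map (λ x → - f x) xs) ≡ - sumℤ (map f xs)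
sum-neg []       f = refl
sum-neg (x ∷ xs) f = trans (cong (_+_ (- f x)) (sum-neg xs f)) (sym (neg-distrib-+ (f x) _))

sum-swap : {B : Set} (xs : List A) (ys : List B) (F : A → B → ℤ) →
  sumℤ (map (λ x → sumℤ (map (F x) ys)) xs) ≡ sumℤ (map (λ y → sumℤ (map (λ x → F x y) xs)) ys)
sum-swap []       ys F = sym (sum-zero ys)
sum-swap (x ∷ xs) ys F =
  trans (cong (_+_ (sumℤ (map (F x) ys))) (sum-swap xs ys F))
        (sym (sum-+ ys (F x) (λ y → sumℤ (map (λ x → F x y) xs))))

sum-allFin-suc : ∀ N (h : Fin (suc N) → ℤ) →
  sumℤ (map h (allFin (suc N))) ≡ h fz + sumℤ (map (h ∘ fs) (allFin N))
sum-allFin-suc N h =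
  cong (_+_ (h fz)) (cong sumℤ (trans (Listₚ.map-tabulate fs h) (sym (Listₚ.map-tabulate (λ i → i) (h ∘ fs)))))

-- Finite differences and the value at −1

Δ : (ℕ → ℤ) → ℕ → ℤ
Δ f N = f (suc N) - f N

shift : (ℕ → ℤ) → ℕ → ℤ
shift f N = f (suc N)

Degree≤ : ℕ → (ℕ → ℤ) → Set
Degree≤ zero    f = ∀ N → f (suc N) ≡ f N
Degree≤ (suc d) f = Degree≤ d (Δ f)

-- Σ_{k ≤ d} (−1)^k Δ^k f(0): Newton's forward formula at N = −1, where binom(−1, k) = (−1)^k.
valueAt-1 : ℕ → (ℕ → ℤ) → ℤ
valueAt-1 zero    f = f 0
valueAt-1 (suc d) f = f 0 - valueAt-1 d (Δ f)

record PolyAt-1 (d : ℕ) (f : ℕ → ℤ) (v : ℤ) : Set where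
  field
    degree≤ : Degree≤ d f
    value   : valueAt-1 d f ≡ v
open PolyAt-1

Δ-cong : ∀ {f g} → f ≗ g → Δ f ≗ Δ g
Δ-cong e N = cong₂ _-_ (e (suc N)) (e N)

Degree≤-cong : ∀ d {f g} → f ≗ g → Degree≤ d f → Degree≤ d g
Degree≤-cong zero    e D N = trans (sym (e (suc N))) (trans (D N) (e N))
Degree≤-cong (suc d) e D   = Degree≤-cong d (Δ-cong e) D

valueAt-1-cong : ∀ d {f g} → f ≗ g → valueAt-1 d f ≡ valueAt-1 d g
valueAt-1-cong zero    e = e 0
valueAt-1-cong (suc d) e = cong₂ _-_ (e 0) (valueAt-1-cong d (Δ-cong e))

PolyAt-1-cong : ∀ {d f g v} → f ≗ g → PolyAt-1 d f v → PolyAt-1 d g v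
PolyAt-1-cong {d} e P = record
  { degree≤ = Degree≤-cong d e (degree≤ P) ; value = trans (sym (valueAt-1-cong d e)) (value P) }

PolyAt-1-value≡ : ∀ {d f u v} → PolyAt-1 d f u → u ≡ v → PolyAt-1 d f v
PolyAt-1-value≡ P refl = P

PolyAt-1-unique : ∀ {d f u v} → PolyAt-1 d f u → PolyAt-1 d f v → u ≡ v
PolyAt-1-unique P Q = trans (sym (value P)) (value Q)

PolyAt-1-fromΔ : ∀ {d f w v} → PolyAt-1 d (Δ f) w → f 0 - w ≡ v → PolyAt-1 (suc d) f v
PolyAt-1-fromΔ {f = f} P eq = record { degree≤ = degree≤ P ; value = trans (cong (_-_ (f 0)) (value P)) eq }

PolyAt-1-Δ : ∀ {d f v} → PolyAt-1 (suc d) f v → PolyAt-1 d (Δ f) (f 0 - v)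
PolyAt-1-Δ {d} {f} P = record
  { degree≤ = degree≤ P
  ; value   = trans (sym (cancel (f 0) (valueAt-1 d (Δ f)))) (cong (_-_ (f 0)) (value P)) }
  where
  cancel : ∀ (a x : ℤ) → a - (a - x) ≡ x
  cancel = solve-∀

Degree-0⇒constant : ∀ {f} → Degree≤ 0 f → f ≗ λ _ → f 0
Degree-0⇒constant D zero    = refl
Degree-0⇒constant D (suc N) = trans (D N) (Degree-0⇒constant D N)

Degree≤-suc : ∀ d {f} → Degree≤ d f → Degree≤ (suc d) f
Degree≤-suc zero    {f} D N = trans (vanishes (suc N)) (sym (vanishes N))
  where
  vanishes : ∀ N → Δ f N ≡ + 0
  vanishes N = trans (cong (_- f N) (D N)) (+-inverseʳ (f N))
Degree≤-suc (suc d) D = Degree≤-suc d D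

valueAt-1-suc : ∀ d {f} → Degree≤ d f → valueAt-1 (suc d) f ≡ valueAt-1 d f
valueAt-1-suc zero    {f} D =
  trans (cong (λ z → f 0 - (z - f 0)) (D 0)) (trans (cong (_-_ (f 0)) (+-inverseʳ (f 0))) (+-identityʳ (f 0)))
valueAt-1-suc (suc d) {f} D = cong (_-_ (f 0)) (valueAt-1-suc d D)

PolyAt-1-suc : ∀ {d f v} → PolyAt-1 d f v → PolyAt-1 (suc d) f v
PolyAt-1-suc {d} P = record
  { degree≤ = Degree≤-suc d (degree≤ P) ; value = trans (valueAt-1-suc d (degree≤ P)) (value P) }

PolyAt-1-mono : ∀ {d e f v} → d ≤ e → PolyAt-1 d f v → PolyAt-1 e f v
PolyAt-1-mono d≤e P = raise (ℕₚ.≤⇒≤′ d≤e)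
  where
  raise : ∀ {e} → _ ℕ.≤′ e → PolyAt-1 e _ _
  raise ℕ.≤′-refl      = P
  raise (ℕ.≤′-step d≤′e) = PolyAt-1-suc (raise d≤′e)

PolyAt-1-zero : ∀ {d} → PolyAt-1 d (λ _ → + 0) (+ 0)
PolyAt-1-zero {zero}  = record { degree≤ = λ _ → refl ; value = refl }
PolyAt-1-zero {suc d} = PolyAt-1-fromΔ (PolyAt-1-cong (λ _ → sym (+-inverseʳ (+ 0))) PolyAt-1-zero) refl

Δ-+ : ∀ f g → Δ (λ N → f N + g N) ≗ λ N → Δ f N + Δ g N
Δ-+ f g N = interchange (f (suc N)) (g (suc N)) (f N) (g N)
  where
  interchange : ∀ (a b c d : ℤ) → (a + b) - (c + d) ≡ (a - c) + (b - d)
  interchange = solve-∀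

PolyAt-1-+ : ∀ {d f g u v} → PolyAt-1 d f u → PolyAt-1 d g v → PolyAt-1 d (λ N → f N + g N) (u + v)
PolyAt-1-+ {zero} P Q = record
  { degree≤ = λ N → cong₂ _+_ (degree≤ P N) (degree≤ Q N) ; value = cong₂ _+_ (value P) (value Q) }
PolyAt-1-+ {suc d} {f} {g} {u} {v} P Q =
  PolyAt-1-fromΔ (PolyAt-1-cong (λ N → sym (Δ-+ f g N)) (PolyAt-1-+ (PolyAt-1-Δ P) (PolyAt-1-Δ Q)))
    (regroup (f 0) (g 0) u v)
  where
  regroup : ∀ (a b u v : ℤ) → (a + b) - ((a - u) + (b - v)) ≡ u + v
  regroup = solve-∀

Δ-*ˡ : ∀ c f → Δ (λ N → c * f N) ≗ λ N → c * Δ f N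
Δ-*ˡ c f N = distrib c (f (suc N)) (f N)
  where
  distrib : ∀ (c a b : ℤ) → c * a - c * b ≡ c * (a - b)
  distrib = solve-∀

PolyAt-1-*ˡ : ∀ {d f v} c → PolyAt-1 d f v → PolyAt-1 d (λ N → c * f N) (c * v)
PolyAt-1-*ˡ {zero} c P = record { degree≤ = λ N → cong (c *_) (degree≤ P N) ; value = cong (c *_) (value P) }
PolyAt-1-*ˡ {suc d} {f} {v} c P =
  PolyAt-1-fromΔ (PolyAt-1-cong (λ N → sym (Δ-*ˡ c f N)) (PolyAt-1-*ˡ c (PolyAt-1-Δ P))) (regroup c (f 0) v)
  where
  regroup : ∀ (c a v : ℤ) → c * a - c * (a - v) ≡ c * v
  regroup = solve-∀

PolyAt-1-sum : ∀ {d} {xs : List A} {h : A → ℕ → ℤ} {v : A → ℤ} → All (λ x → PolyAt-1 d (h x) (v x)) xs →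
  PolyAt-1 d (λ N → sumℤ (map (λ x → h x N) xs)) (sumℤ (map v xs))
PolyAt-1-sum []       = PolyAt-1-zero
PolyAt-1-sum (P ∷ Ps) = PolyAt-1-+ P (PolyAt-1-sum Ps)

PolyAt-1-shift : ∀ {d f v} → PolyAt-1 d f v → PolyAt-1 d (shift f) (f 0)
PolyAt-1-shift {zero} P = record { degree≤ = λ N → degree≤ P (suc N) ; value = degree≤ P 0 }
PolyAt-1-shift {suc d} {f} P =
  PolyAt-1-fromΔ (PolyAt-1-shift (PolyAt-1-Δ P)) (cancel (f 1) (f 0))
  where
  cancel : ∀ (a b : ℤ) → a - (a - b) ≡ b
  cancel = solve-∀

Δ-* : ∀ f g → Δ (λ N → f N * g N) ≗ λ N → shift f N * Δ g N + Δ f N * g N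
Δ-* f g N = leibniz (f (suc N)) (g (suc N)) (f N) (g N)
  where
  leibniz : ∀ (a b c d : ℤ) → a * b - c * d ≡ a * (b - d) + (a - c) * d
  leibniz = solve-∀

PolyAt-1-* : ∀ a b {f g u v} → PolyAt-1 a f u → PolyAt-1 b g v →
  PolyAt-1 (a ℕ.+ b) (λ N → f N * g N) (u * v)
PolyAt-1-* zero b {f} {g} {u} {v} P Q =
  PolyAt-1-value≡
    (PolyAt-1-cong (λ N → cong (_* g N) (sym (Degree-0⇒constant (degree≤ P) N))) (PolyAt-1-*ˡ (f 0) Q))
    (cong (_* v) (value P))
PolyAt-1-* (suc a) zero {f} {g} {u} {v} P Q =
  PolyAt-1-value≡ (PolyAt-1-cong (λ N → *-comm (g N) (f N))
    (PolyAt-1-mono (ℕₚ.≤-reflexive (sym (ℕₚ.+-identityʳ (suc a)))) (PolyAt-1-* zero (suc a) Q P))) (*-comm v u)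
PolyAt-1-* (suc a) (suc b) {f} {g} {u} {v} P Q =
  PolyAt-1-fromΔ (PolyAt-1-cong (λ N → sym (Δ-* f g N)) (PolyAt-1-+ shifted differenced)) (regroup (f 0) (g 0) u v)
  where
  shifted : PolyAt-1 (a ℕ.+ suc b) (λ N → shift f N * Δ g N) (f 0 * (g 0 - v))
  shifted = PolyAt-1-mono (ℕₚ.≤-reflexive (sym (ℕₚ.+-suc a b)))
              (PolyAt-1-* (suc a) b (PolyAt-1-shift P) (PolyAt-1-Δ Q))
  differenced : PolyAt-1 (a ℕ.+ suc b) (λ N → Δ f N * g N) ((f 0 - u) * v)
  differenced = PolyAt-1-* a (suc b) (PolyAt-1-Δ P) Q
  regroup : ∀ (a b u v : ℤ) → a * b - (a * (b - v) + (a - u) * v) ≡ u * v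
  regroup = solve-∀

ones : ∀ {N} → Fin N → ℤ
ones _ = + 1

esym-ones-pascal : ∀ k → Δ (λ N → esym N ones (suc k)) ≗ λ N → esym N ones k
esym-ones-pascal k N = pascal (esym N ones k) (esym N ones (suc k))
  where
  pascal : ∀ (a b : ℤ) → (+ 1 * a + b) - b ≡ a
  pascal = solve-∀

PolyAt-1-esym-ones : ∀ k → PolyAt-1 k (λ N → esym N ones k) (-1ℤ ^ k)
PolyAt-1-esym-ones zero    = record { degree≤ = λ _ → refl ; value = refl }
PolyAt-1-esym-ones (suc k) =
  PolyAt-1-fromΔ (PolyAt-1-cong (λ N → sym (esym-ones-pascal k N)) (PolyAt-1-esym-ones k)) (negate (-1ℤ ^ k))
  where
  negate : ∀ (s : ℤ) → + 0 - s ≡ -1ℤ * s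
  negate = solve-∀

PolyAt-1-eμ-ones : ∀ μ → PolyAt-1 (sum μ) (λ N → eμ N ones μ) (-1ℤ ^ sum μ)
PolyAt-1-eμ-ones []      = record { degree≤ = λ _ → refl ; value = refl }
PolyAt-1-eμ-ones (k ∷ μ) =
  PolyAt-1-value≡ (PolyAt-1-* k (sum μ) (PolyAt-1-esym-ones k) (PolyAt-1-eμ-ones μ))
    (sym (^-distribˡ-+-* -1ℤ k (sum μ)))

partsB-sum : ∀ fuel k m → All (λ μ → sum μ ≡ m) (partsB fuel k m)
partsB-sum fuel       k zero    = refl ∷ []
partsB-sum zero       k (suc m) = []
partsB-sum (suc fuel) k (suc m) =
  concat⁺ (map⁺ (All.map (λ {j} j<m → map⁺ (All.map (λ e → trans (cong (suc j ℕ.+_) e) (ℕₚ.m+[n∸m]≡n j<m))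
                                                           (partsB-sum fuel (suc j) (suc m ℕ.∸ suc j))))
     (filter⁺ (λ j → suc j ℕ.≤? k) (all-filter (λ j → suc j ℕ.≤? suc m) (Data.List.upTo (suc m))))))

-- Maps into [N+1] sorted by the set of vertices sent to the minimum

mapSum : ∀ m N → (Vec (Fin N) m → ℤ) → ℤ
mapSum m N w = sumℤ (map w (allVecs m N))

mapSum-suc : ∀ m N (w : Vec (Fin N) (suc m) → ℤ) →
  mapSum (suc m) N w ≡ sumℤ (map (λ k → mapSum m N (w ∘ (k ∷_))) (allFin N))
mapSum-suc m N w = trans (sum-concatMap (allFin N) (λ k → map (k ∷_) (allVecs m N)) w)
                         (sum-cong (allFin N) (λ k → sum-map (allVecs m N) (k ∷_) w))

subsets : ∀ m → List (Subset m)
subsets zero    = [] ∷ []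
subsets (suc m) = map (inside ∷_) (subsets m) ++ map (outside ∷_) (subsets m)

nonemptySubsets : ∀ m → List (Subset m)
nonemptySubsets zero    = []
nonemptySubsets (suc m) = map (inside ∷_) (subsets m) ++ map (outside ∷_) (nonemptySubsets m)

∣_∣ᶜ : ∀ {m} → Subset m → ℕ
∣ []          ∣ᶜ = 0
∣ inside  ∷ p ∣ᶜ = ∣ p ∣ᶜ
∣ outside ∷ p ∣ᶜ = suc ∣ p ∣ᶜ

zeroOn : ∀ {m N} (p : Subset m) → Vec (Fin N) ∣ p ∣ᶜ → Vec (Fin (suc N)) m
zeroOn []            G       = []
zeroOn (inside  ∷ p) G       = fz ∷ zeroOn p G
zeroOn (outside ∷ p) (g ∷ G) = fs g ∷ zeroOn p G

mapSum-byZeroSet : ∀ m N (w : Vec (Fin (suc N)) m → ℤ) →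
  mapSum m (suc N) w ≡ sumℤ (map (λ p → mapSum ∣ p ∣ᶜ N (w ∘ zeroOn p)) (subsets m))
mapSum-byZeroSet zero    N w = sym (+-identityʳ _)
mapSum-byZeroSet (suc m) N w = begin
    mapSum (suc m) (suc N) w
  ≡⟨ trans (mapSum-suc m (suc N) w) (sum-allFin-suc N (λ k → mapSum m (suc N) (w ∘ (k ∷_)))) ⟩
    mapSum m (suc N) (w ∘ (fz ∷_)) + sumℤ (map (λ g → mapSum m (suc N) (w ∘ (fs g ∷_))) (allFin N))
  ≡⟨ cong₂ _+_ (mapSum-byZeroSet m N (w ∘ (fz ∷_)))
               (trans (sum-cong (allFin N) (λ g → mapSum-byZeroSet m N (w ∘ (fs g ∷_))))
                      (sum-swap (allFin N) (subsets m) shifted)) ⟩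
    sumℤ (map (H ∘ (inside ∷_)) (subsets m)) + sumℤ (map (λ p → sumℤ (map (λ g → shifted g p) (allFin N))) (subsets m))
  ≡⟨ cong₂ _+_ (sym (sum-map (subsets m) (inside ∷_) H))
       (trans (sum-cong (subsets m) (λ p → sym (mapSum-suc ∣ p ∣ᶜ N (w ∘ zeroOn (outside ∷ p)))))
              (sym (sum-map (subsets m) (outside ∷_) H))) ⟩
    sumℤ (map H (map (inside ∷_) (subsets m))) + sumℤ (map H (map (outside ∷_) (subsets m)))
  ≡⟨ sym (sum-++ (map (inside ∷_) (subsets m)) (map (outside ∷_) (subsets m)) H) ⟩
    sumℤ (map H (subsets (suc m)))
  ∎
  where
  open ≡-Reasoning
  H : Subset (suc m) → ℤ
  H p = mapSum ∣ p ∣ᶜ N (w ∘ zeroOn p)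
  shifted : Fin N → Subset m → ℤ
  shifted g p = mapSum ∣ p ∣ᶜ N (w ∘ (fs g ∷_) ∘ zeroOn p)

mapSum-zeroOn-⊥ : ∀ m N (w : Vec (Fin (suc N)) m → ℤ) →
  mapSum ∣ ⊥ {m} ∣ᶜ N (w ∘ zeroOn ⊥) ≡ mapSum m N (w ∘ Vec.map fs)
mapSum-zeroOn-⊥ zero    N w = refl
mapSum-zeroOn-⊥ (suc m) N w =
  trans (mapSum-suc ∣ ⊥ {m} ∣ᶜ N (w ∘ zeroOn ⊥))
    (trans (sum-cong (allFin N) (λ g → mapSum-zeroOn-⊥ m N (w ∘ (fs g ∷_))))
           (sym (mapSum-suc m N (w ∘ Vec.map fs))))

subsets-split : ∀ m (H : Subset m → ℤ) → sumℤ (map H (subsets m)) ≡ H ⊥ + sumℤ (map H (nonemptySubsets m))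
subsets-split zero    H = refl
subsets-split (suc m) H = begin
    sumℤ (map H (subsets (suc m)))
  ≡⟨ sum-++ (map (inside ∷_) (subsets m)) (map (outside ∷_) (subsets m)) H ⟩
    Σinside + sumℤ (map H (map (outside ∷_) (subsets m)))
  ≡⟨ cong (_+_ Σinside) (trans (sum-map (subsets m) (outside ∷_) H)
       (trans (subsets-split m (H ∘ (outside ∷_)))
              (cong (_+_ (H ⊥)) (sym (sum-map (nonemptySubsets m) (outside ∷_) H))))) ⟩
    Σinside + (H ⊥ + sumℤ (map H (map (outside ∷_) (nonemptySubsets m))))
  ≡⟨ swap Σinside (H ⊥) _ ⟩
    H ⊥ + (Σinside + sumℤ (map H (map (outside ∷_) (nonemptySubsets m))))
  ≡⟨ cong (_+_ (H ⊥)) (sym (sum-++ (map (inside ∷_) (subsets m)) (map (outside ∷_) (nonemptySubsets m)) H)) ⟩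
    H ⊥ + sumℤ (map H (nonemptySubsets (suc m)))
  ∎
  where
  open ≡-Reasoning
  Σinside : ℤ
  Σinside = sumℤ (map H (map (inside ∷_) (subsets m)))
  swap : ∀ (a b c : ℤ) → a + (b + c) ≡ b + (a + c)
  swap = solve-∀

∣⊥∣ᶜ : ∀ m → ∣ ⊥ {m} ∣ᶜ ≡ m
∣⊥∣ᶜ zero    = refl
∣⊥∣ᶜ (suc m) = cong suc (∣⊥∣ᶜ m)

∣∣ᶜ≤ : ∀ {m} (p : Subset m) → ∣ p ∣ᶜ ≤ m
∣∣ᶜ≤ []            = z≤n
∣∣ᶜ≤ (inside  ∷ p) = ℕₚ.m≤n⇒m≤1+n (∣∣ᶜ≤ p)
∣∣ᶜ≤ (outside ∷ p) = s≤s (∣∣ᶜ≤ p)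

nonemptySubsets-∣∣ᶜ< : ∀ m → All (λ p → ∣ p ∣ᶜ < m) (nonemptySubsets m)
nonemptySubsets-∣∣ᶜ< zero    = []
nonemptySubsets-∣∣ᶜ< (suc m) =
  ++⁺ (map⁺ (All.universal (λ p → s≤s (∣∣ᶜ≤ p)) (subsets m)))
      (map⁺ (All.map s≤s (nonemptySubsets-∣∣ᶜ< m)))

-- Weights that depend only on the comparisons F(i) < F(j) for i < j

Pattern : ℕ → Set
Pattern m = Fin m → Fin m → Bool

patternOf : ∀ {m N} → Vec (Fin N) m → Pattern m
patternOf G i j = toℕ (lookup G i) <ᵇ toℕ (lookup G j)

increasing : ∀ {m} → Pattern m
increasing i j = toℕ i <ᵇ toℕ j

AgreeOnForwardPairs : ∀ {m} → Pattern m → Pattern m → Set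
AgreeOnForwardPairs c c′ = ∀ i j → toℕ i < toℕ j → c i j ≡ c′ i j

ForwardInvariant : ∀ m → (Pattern m → ℤ) → Set
ForwardInvariant m Ψ = ∀ {c c′} → AgreeOnForwardPairs c c′ → Ψ c ≡ Ψ c′

patternSum : ∀ m → (Pattern m → ℤ) → ℕ → ℤ
patternSum m Ψ N = mapSum m N (Ψ ∘ patternOf)

rankOutside : ∀ {m} (p : Subset m) → Fin m → Maybe (Fin ∣ p ∣ᶜ)
rankOutside (inside  ∷ p) fz     = nothing
rankOutside (outside ∷ p) fz     = just fz
rankOutside (inside  ∷ p) (fs i) = rankOutside p i
rankOutside (outside ∷ p) (fs i) = Maybe.map fs (rankOutside p i)

-- Vertices in the zero set (rank nothing) lie strictly below all others.
compareRanks : ∀ {k} → Maybe (Fin k) → Maybe (Fin k) → Pattern k → Bool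
compareRanks _        nothing  c = false
compareRanks nothing  (just _) c = true
compareRanks (just i) (just j) c = c i j

zeroOnPattern : ∀ {m} (p : Subset m) → Pattern ∣ p ∣ᶜ → Pattern m
zeroOnPattern p c i j = compareRanks (rankOutside p i) (rankOutside p j) c

valueAtRank : ∀ {k N} → Maybe (Fin k) → Vec (Fin N) k → Fin (suc N)
valueAtRank nothing  G = fz
valueAtRank (just i) G = fs (lookup G i)

lookup-zeroOn : ∀ {m N} (p : Subset m) (G : Vec (Fin N) ∣ p ∣ᶜ) i →
  lookup (zeroOn p G) i ≡ valueAtRank (rankOutside p i) G
lookup-zeroOn (inside  ∷ p) G       fz     = refl
lookup-zeroOn (inside  ∷ p) G       (fs i) = lookup-zeroOn p G i
lookup-zeroOn (outside ∷ p) (g ∷ G) fz     = refl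
lookup-zeroOn (outside ∷ p) (g ∷ G) (fs i) = trans (lookup-zeroOn p G i) (valueAtRank-suc (rankOutside p i))
  where
  valueAtRank-suc : ∀ x → valueAtRank x G ≡ valueAtRank (Maybe.map fs x) (g ∷ G)
  valueAtRank-suc nothing  = refl
  valueAtRank-suc (just _) = refl

patternOf-zeroOn : ∀ {m N} (p : Subset m) (G : Vec (Fin N) ∣ p ∣ᶜ) i j →
  patternOf (zeroOn p G) i j ≡ zeroOnPattern p (patternOf G) i j
patternOf-zeroOn p G i j rewrite lookup-zeroOn p G i | lookup-zeroOn p G j = compare (rankOutside p i) (rankOutside p j)
  where
  compare : ∀ x y → (toℕ (valueAtRank x G) <ᵇ toℕ (valueAtRank y G)) ≡ compareRanks x y (patternOf G)
  compare x        nothing  = refl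
  compare nothing  (just j) = refl
  compare (just i) (just j) = refl

patternOf-map-suc : ∀ {m N} (G : Vec (Fin N) m) i j → patternOf (Vec.map fs G) i j ≡ patternOf G i j
patternOf-map-suc G i j rewrite Vecₚ.lookup-map i fs G | Vecₚ.lookup-map j fs G = refl

map-suc≡just : ∀ {k} (x : Maybe (Fin k)) {y} → Maybe.map fs x ≡ just y →
  Σ (Fin k) λ z → x ≡ just z × y ≡ fs z
map-suc≡just (just z) refl = z , refl , refl

rankOutside-monotone : ∀ {m} (p : Subset m) i j {i′ j′} → rankOutside p i ≡ just i′ → rankOutside p j ≡ just j′ →
  toℕ i < toℕ j → toℕ i′ < toℕ j′
rankOutside-monotone (inside  ∷ p) (fs i) (fs j) eqi eqj (s≤s i<j) = rankOutside-monotone p i j eqi eqj i<j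
rankOutside-monotone (outside ∷ p) fz     (fs j) refl eqj _ with map-suc≡just (rankOutside p j) eqj
... | _ , _ , refl = s≤s z≤n
rankOutside-monotone (outside ∷ p) (fs i) (fs j) eqi eqj (s≤s i<j)
  with map-suc≡just (rankOutside p i) eqi | map-suc≡just (rankOutside p j) eqj
... | _ , eqi′ , refl | _ , eqj′ , refl = s≤s (rankOutside-monotone p i j eqi′ eqj′ i<j)

zeroOnPattern-cong : ∀ {m} (p : Subset m) {c c′} → AgreeOnForwardPairs c c′ →
  AgreeOnForwardPairs (zeroOnPattern p c) (zeroOnPattern p c′)
zeroOnPattern-cong p c≈c′ i j i<j with rankOutside p i in eqi | rankOutside p j in eqj
... | _        | nothing  = refl
... | nothing  | just _   = refl
... | just i′  | just j′  = c≈c′ i′ j′ (rankOutside-monotone p i j eqi eqj i<j)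

outsidePattern : ∀ {m} → Subset m → Pattern m
outsidePattern p i j = is-just (rankOutside p j)

zeroOnPattern-increasing : ∀ {m} (p : Subset m) → AgreeOnForwardPairs (zeroOnPattern p increasing) (outsidePattern p)
zeroOnPattern-increasing p i j i<j with rankOutside p i in eqi | rankOutside p j in eqj
... | _       | nothing = refl
... | nothing | just _  = refl
... | just i′ | just j′ = Equivalence.to Boolₚ.T-≡ (ℕₚ.<⇒<ᵇ (rankOutside-monotone p i j eqi eqj i<j))

is-just-map : ∀ {k} (x : Maybe (Fin k)) → is-just (Maybe.map fs x) ≡ is-just x
is-just-map nothing  = refl
is-just-map (just _) = refl

outsidePattern-⊥ : ∀ m → AgreeOnForwardPairs (outsidePattern (⊥ {m})) increasing
outsidePattern-⊥ m i j i<j = trans (outside-⊥ m j) (sym (Equivalence.to Boolₚ.T-≡ (ℕₚ.<⇒<ᵇ i<j)))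
  where
  outside-⊥ : ∀ m (j : Fin m) → is-just (rankOutside ⊥ j) ≡ true
  outside-⊥ (suc m) fz     = refl
  outside-⊥ (suc m) (fs j) = trans (is-just-map (rankOutside ⊥ j)) (outside-⊥ m j)

outsidePattern-head : ∀ {m} (p : Subset m) →
  AgreeOnForwardPairs (outsidePattern (outside ∷ p)) (outsidePattern (inside ∷ p))
outsidePattern-head p i (fs j) _ = is-just-map (rankOutside p j)

ForwardInvariant-zeroOnPattern : ∀ {m Ψ} (p : Subset m) → ForwardInvariant m Ψ →
  ForwardInvariant ∣ p ∣ᶜ (Ψ ∘ zeroOnPattern p)
ForwardInvariant-zeroOnPattern p inv c≈c′ = inv (zeroOnPattern-cong p c≈c′)

Δ-patternSum : ∀ m {Ψ} → ForwardInvariant m Ψ →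
  Δ (patternSum m Ψ) ≗ λ N → sumℤ (map (λ p → patternSum ∣ p ∣ᶜ (Ψ ∘ zeroOnPattern p) N) (nonemptySubsets m))
Δ-patternSum m {Ψ} inv N = trans (cong (_- patternSum m Ψ N) split) (cancel (patternSum m Ψ N) _)
  where
  H : Subset m → ℤ
  H p = mapSum ∣ p ∣ᶜ N (Ψ ∘ patternOf ∘ zeroOn p)
  split : patternSum m Ψ (suc N) ≡
    patternSum m Ψ N + sumℤ (map (λ p → patternSum ∣ p ∣ᶜ (Ψ ∘ zeroOnPattern p) N) (nonemptySubsets m))
  split = trans (mapSum-byZeroSet m N (Ψ ∘ patternOf)) (trans (subsets-split m H)
            (cong₂ _+_
              (trans (mapSum-zeroOn-⊥ m N (Ψ ∘ patternOf))
                     (sum-cong (allVecs m N) (λ G → inv (λ i j _ → patternOf-map-suc G i j))))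
              (sum-cong (nonemptySubsets m) (λ p → sum-cong (allVecs ∣ p ∣ᶜ N)
                                                   (λ G → inv (λ i j _ → patternOf-zeroOn p G i j))))))
  cancel : ∀ (a b : ℤ) → a + b - a ≡ b
  cancel = solve-∀

signedOutside : ∀ {m} → (Pattern m → ℤ) → Subset m → ℤ
signedOutside Ψ p = -1ℤ ^ ∣ p ∣ᶜ * Ψ (outsidePattern p)

-- Toggling the first vertex flips the sign, and the outside pattern ignores it on forward pairs.
alternatingSum-vanishes : ∀ m {Ψ} → ForwardInvariant (suc m) Ψ →
  sumℤ (map (signedOutside Ψ) (subsets (suc m))) ≡ + 0
alternatingSum-vanishes m {Ψ} inv = begin
    sumℤ (map H (subsets (suc m)))
  ≡⟨ sum-++ (map (inside ∷_) (subsets m)) (map (outside ∷_) (subsets m)) H ⟩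
    sumℤ (map H (map (inside ∷_) (subsets m))) + sumℤ (map H (map (outside ∷_) (subsets m)))
  ≡⟨ cong₂ _+_ (sum-map (subsets m) (inside ∷_) H)
       (trans (sum-map (subsets m) (outside ∷_) H)
         (trans (sum-cong (subsets m) (λ p → trans (cong (-1ℤ * -1ℤ ^ ∣ p ∣ᶜ *_) (inv (outsidePattern-head p)))
                                                  (negate (-1ℤ ^ ∣ p ∣ᶜ) _)))
                (sum-neg (subsets m) (H ∘ (inside ∷_))))) ⟩
    sumℤ (map (H ∘ (inside ∷_)) (subsets m)) - sumℤ (map (H ∘ (inside ∷_)) (subsets m))
  ≡⟨ +-inverseʳ (sumℤ (map (H ∘ (inside ∷_)) (subsets m))) ⟩
    + 0
  ∎
  where
  open ≡-Reasoning
  H = signedOutside Ψ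
  negate : ∀ (s x : ℤ) → -1ℤ * s * x ≡ - (s * x)
  negate = solve-∀

reciprocity : ∀ m {Ψ} → ForwardInvariant m Ψ → PolyAt-1 m (patternSum m Ψ) (-1ℤ ^ m * Ψ increasing)
reciprocity = <-rec Reciprocity step
  where
  Reciprocity : ℕ → Set
  Reciprocity m = ∀ {Ψ} → ForwardInvariant m Ψ → PolyAt-1 m (patternSum m Ψ) (-1ℤ ^ m * Ψ increasing)
  step : ∀ m → (∀ {k} → k < m → Reciprocity k) → Reciprocity m
  step zero    _  inv = record
    { degree≤ = λ _ → cong (λ z → z + + 0) (inv (λ ()))
    ; value   = trans (+-identityʳ _) (trans (inv (λ ())) (sym (*-identityˡ _))) }
  step (suc m) IH {Ψ} inv =
    PolyAt-1-fromΔ (PolyAt-1-cong (λ N → sym (Δ-patternSum (suc m) inv N))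
                     (PolyAt-1-sum (All.map (λ {p} → piece {p}) (nonemptySubsets-∣∣ᶜ< (suc m)))))
                   value-1
    where
    H = signedOutside Ψ
    piece : ∀ {p} → ∣ p ∣ᶜ < suc m → PolyAt-1 m (patternSum ∣ p ∣ᶜ (Ψ ∘ zeroOnPattern p)) (H p)
    piece {p} smaller = PolyAt-1-mono (ℕₚ.≤-pred smaller)
      (PolyAt-1-value≡ (IH smaller (ForwardInvariant-zeroOnPattern p inv))
        (cong (-1ℤ ^ ∣ p ∣ᶜ *_) (inv (zeroOnPattern-increasing p))))
    nonempty≡-⊥ : sumℤ (map H (nonemptySubsets (suc m))) ≡ - H ⊥
    nonempty≡-⊥ = begin
        sumℤ (map H (nonemptySubsets (suc m)))
      ≡⟨ isolate (H ⊥) _ ⟩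
        - H ⊥ + (H ⊥ + sumℤ (map H (nonemptySubsets (suc m))))
      ≡⟨ cong (_+_ (- H ⊥)) (trans (sym (subsets-split (suc m) H)) (alternatingSum-vanishes m inv)) ⟩
        - H ⊥ + + 0
      ≡⟨ +-identityʳ (- H ⊥) ⟩
        - H ⊥
      ∎
      where
      open ≡-Reasoning
      isolate : ∀ (a b : ℤ) → b ≡ - a + (a + b)
      isolate = solve-∀
    value-1 : + 0 - sumℤ (map H (nonemptySubsets (suc m))) ≡ -1ℤ ^ suc m * Ψ increasing
    value-1 = trans (cong (λ z → + 0 - z) nonempty≡-⊥)
      (trans (trans (+-identityˡ _) (neg-involutive (H ⊥)))
             (cong₂ (λ k x → -1ℤ ^ k * x) (∣⊥∣ᶜ (suc m)) (inv (outsidePattern-⊥ (suc m)))))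

countPairs-cong : ∀ {n} {p p′ : Fin n → Fin n → Bool} → (∀ i j → p i j ≡ p′ i j) → countPairs p ≡ countPairs p′
countPairs-cong {n} e =
  cong length (Listₚ.filter-≐ _ _ ((λ {(i , j)} → trans (sym (e i j))) , (λ {(i , j)} → trans (e i j))) (pairs n))

∧-cong-guarded : ∀ b {x y} → (b ≡ true → x ≡ y) → b ∧ x ≡ b ∧ y
∧-cong-guarded true  x≡y = x≡y refl
∧-cong-guarded false _   = refl

respectsPattern : ∀ {n} → (Fin n → Fin n → Bool) → Pattern n → Bool
respectsPattern s c = countPairs (λ u v → s u v ∧ not (c u v)) ℕ.≡ᵇ 0

ascents : ∀ {n} → (Fin n → ℕ) → Pattern n → ℕ
ascents a c = countPairs (λ i j → isEdgeᵇ a i j ∧ c i j)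

-- The summand of Geval at x = 1 read off the pattern of F, so that Geval a s N ones q is
-- definitionally patternSum n (Gweight a s q) N.
Gweight : ∀ {n} → (Fin n → ℕ) → (Fin n → Fin n → Bool) → ℤ → Pattern n → ℤ
Gweight {n} a s q c = if respectsPattern s c then prodℤ (map ones (allFin n)) * q ^ ascents a c else + 0

Forward : ∀ {n} → (Fin n → Fin n → Bool) → Set
Forward s = ∀ u v → s u v ≡ true → toℕ u < toℕ v

edges-forward : ∀ {n} (a : Fin n → ℕ) → Forward (isEdgeᵇ a)
edges-forward a i j isEdge with toℕ i <ᵇ toℕ j in i<ᵇj
... | true = ℕₚ.<ᵇ⇒< (toℕ i) (toℕ j) (Equivalence.from Boolₚ.T-≡ i<ᵇj)

corners-forward : ∀ {n} (a : Fin n → ℕ) u v → IsCorner a u v → toℕ u < toℕ v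
corners-forward a u v (_ , (u→v-1 , _) , (v-1 , v-1+1≡v) , _) =
  ℕₚ.<-trans (edges-forward a u v-1 (u→v-1 v-1 v-1+1≡v)) (ℕₚ.≤-reflexive v-1+1≡v)

Gweight-forwardInvariant : ∀ {n} (a : Fin n → ℕ) {s} → Forward s → ∀ q → ForwardInvariant n (Gweight a s q)
Gweight-forwardInvariant {n} a {s} s-forward q {c} {c′} c≈c′ =
  cong₂ (λ r k → if r then prodℤ (map ones (allFin n)) * q ^ k else + 0)
    (cong (ℕ._≡ᵇ 0) (countPairs-cong λ u v →
       ∧-cong-guarded (s u v) (λ su,v → cong not (c≈c′ u v (s-forward u v su,v)))))
    (countPairs-cong λ i j → ∧-cong-guarded (isEdgeᵇ a i j) (λ i→j → c≈c′ i j (edges-forward a i j i→j)))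

respectsPattern-increasing : ∀ {n} {s : Fin n → Fin n → Bool} → Forward s → respectsPattern s increasing ≡ true
respectsPattern-increasing {n} {s} s-forward =
  cong (λ xs → length xs ℕ.≡ᵇ 0) (Listₚ.filter-none _ (All.universal unviolated (pairs n)))
  where
  unviolated : ∀ ((u , v) : Fin n × Fin n) → s u v ∧ not (increasing u v) ≢ true
  unviolated (u , v) with s u v in su,v
  ... | false = λ ()
  ... | true rewrite Equivalence.to Boolₚ.T-≡ (ℕₚ.<⇒<ᵇ (s-forward u v su,v)) = λ ()

ascents-increasing : ∀ {n} (a : Fin n → ℕ) → ascents a increasing ≡ numEdges a
ascents-increasing a = countPairs-cong absorb
  where
  absorb : ∀ i j → isEdgeᵇ a i j ∧ increasing i j ≡ isEdgeᵇ a i j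
  absorb i j with toℕ i <ᵇ toℕ j
  ... | true  = Boolₚ.∧-identityʳ _
  ... | false = refl

prodℤ-ones : (xs : List A) → prodℤ (map (λ _ → + 1) xs) ≡ + 1
prodℤ-ones []       = refl
prodℤ-ones (x ∷ xs) = trans (*-identityˡ _) (prodℤ-ones xs)

Gweight-increasing : ∀ {n} (a : Fin n → ℕ) {s} → Forward s → ∀ q → Gweight a s q increasing ≡ q ^ numEdges a
Gweight-increasing {n} a s-forward q rewrite respectsPattern-increasing s-forward =
  trans (cong₂ _*_ (prodℤ-ones (allFin n)) (cong (q ^_) (ascents-increasing a))) (*-identityˡ _)

PolyAt-1-Geval-ones : ∀ {n} (a : Fin n → ℕ) {s} → Forward s → ∀ q →
  PolyAt-1 n (λ N → Geval a s N ones q) (-1ℤ ^ n * q ^ numEdges a)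
PolyAt-1-Geval-ones {n} a s-forward q =
  PolyAt-1-value≡ (reciprocity n (Gweight-forwardInvariant a s-forward q))
    (cong (-1ℤ ^ n *_) (Gweight-increasing a s-forward q))

PolyAt-1-eμ-ones-partition : ∀ {n μ} → sum μ ≡ n → PolyAt-1 n (λ N → eμ N ones μ) (-1ℤ ^ n)
PolyAt-1-eμ-ones-partition {μ = μ} refl = PolyAt-1-eμ-ones μ

-1^-cancel : ∀ n {x y} → x * -1ℤ ^ n ≡ -1ℤ ^ n * y → x ≡ y
-1^-cancel n {x} {y} eq = *-cancelʳ-≡ x y (-1ℤ ^ n) {{≢-nonZero -1^n≢0}} (trans eq (*-comm (-1ℤ ^ n) y))
  where
  -1^n≢0 : -1ℤ ^ n ≢ + 0
  -1^n≢0 eq with i^n≡0⇒i≡0 -1ℤ n eq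
  ... | ()

mainTheorem6 : (n : ℕ) (a : Fin n → ℕ) → IsAreaSeq n a →
    (s : Fin n → Fin n → Bool) → (∀ u v → s u v ≡ true → IsCorner a u v) →
    (d : List ℕ → List ℤ) →
    (∀ (N : ℕ) (x : Fin N → ℤ) (q : ℤ) →
    Geval a s N x (q + + 1) ≡ sumℤ (map (λ μ → evalPoly (d μ) q * eμ N x μ) (partitions n))) →
    ∀ (q : ℤ) → sumℤ (map (λ μ → evalPoly (d μ) q) (partitions n)) ≡ (+ 1 + q) ^ numEdges a
mainTheorem6 n a _ s corners d expansion q =
  -1^-cancel n (trans (sym (sum-*ʳ (partitions n) (-1ℤ ^ n) (λ μ → evalPoly (d μ) q)))
                      (PolyAt-1-unique expanded direct))
  where
  s-forward : Forward s
  s-forward u v su,v = corners-forward a u v (corners u v su,v)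
  expanded : PolyAt-1 n (λ N → Geval a s N ones (q + + 1))
                        (sumℤ (map (λ μ → evalPoly (d μ) q * -1ℤ ^ n) (partitions n)))
  expanded = PolyAt-1-cong (λ N → sym (expansion N ones q))
    (PolyAt-1-sum (All.map (λ {μ} |μ|≡n → PolyAt-1-*ˡ (evalPoly (d μ) q) (PolyAt-1-eμ-ones-partition {μ = μ} |μ|≡n))
                           (partsB-sum n n n)))
  direct : PolyAt-1 n (λ N → Geval a s N ones (q + + 1)) (-1ℤ ^ n * (+ 1 + q) ^ numEdges a)
  direct = PolyAt-1-value≡ (PolyAt-1-Geval-ones a s-forward (q + + 1))
    (cong (λ x → -1ℤ ^ n * x ^ numEdges a) (+-comm q (+ 1)))
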